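{- For all integers $s\ge 3$ and $m\ge 1$, the graph $K_{1,s}\times P_{2m+2}$ is antimagic.
   Context: $K_{1,s}$ denotes the star with one center and $s$ leaves, and $P_n$ denotes the path on $n$ vertices. For graphs $G$ and $H$, the direct product $G\times H$ has vertex set $V(G)\times V(H)$, with $(x,y)$ adjacent to $(x',y')$ if and only if $xx'\in E(G)$ and $yy'\in E(H)$. A (possibly disconnected) graph $G$ is antimagic if there is a bijection $f:E(G)\to\{1,2,\dots,|E(G)|\}$ such that the vertex sums $\sum_{e\ni v} f(e)$ are pairwise distinct over all vertices $v$ of $G$. -}

module Defs where

open import Data.Nat using (ℕ; zero; suc; _+_; _*_; _<_; _≤_; _<ᵇ_)
open import Data.Bool using (Bool; true; false; _∧_; _∨_; if_then_else_)
open import Data.Fin using (Fin; toℕ; _≟_)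
open import Data.Fin.Properties using (_≟_)
open import Data.Product using (_×_; _,_; proj₁; proj₂; Σ; ∃)
open import Data.List using (List; []; _∷_; map; filter; length; allFin; cartesianProduct; concatMap)
open import Data.Nat.Base using (_≡ᵇ_)
open import Data.Nat.ListAction using (sum)
open import Relation.Binary.PropositionalEquality using (_≡_; _≢_)
open import Relation.Nullary using (¬_)
open import Relation.Nullary.Decidable using (⌊_⌋)
open import Data.Fin using (inject₁)

-- A finite simple graph on vertex set Fin n, given by a Boolean adjacency
-- relation (assumed symmetric and irreflexive; the constructions below are).
record Graph : Set where
  field
    n   : ℕ
    adj : Fin n → Fin n → Bool
open Graph public

V : Graph → Set
V G = Fin (n G)

verts : (G : Graph) → List (V G)
verts G = allFin (n G)

edges : (G : Graph) → List (V G × V G)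
edges G = filter (λ e → Data.Bool._≟_ (adj G (proj₁ e) (proj₂ e) ∧ (toℕ (proj₁ e) <ᵇ toℕ (proj₂ e))) true)
                 (cartesianProduct (verts G) (verts G))

|E| : Graph → ℕ
|E| G = length (edges G)

-- edge labelling: a function assigning a natural number to each edge
-- (edges are indexed by their position in the edge list)
Labelling : Graph → Set
Labelling G = Fin (|E| G) → ℕ

incident : (G : Graph) → V G → V G × V G → Bool
incident G v (a , b) = ⌊ v ≟ a ⌋ ∨ ⌊ v ≟ b ⌋

vsum : (G : Graph) → Labelling G → V G → ℕ
vsum G f v = sum (map (λ i → if incident G v (Data.List.lookup (edges G) i) then f i else 0)
                      (allFin (|E| G)))

IsBijLabel : (G : Graph) → Labelling G → Set
IsBijLabel G f =
  (∀ i → 1 ≤ f i × f i ≤ |E| G) ×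
  (∀ i j → f i ≡ f j → i ≡ j) ×
  (∀ k → 1 ≤ k → k ≤ |E| G → ∃ λ i → f i ≡ k)

Antimagic : Graph → Set
Antimagic G = Σ (Labelling G) λ f → IsBijLabel G f ×
  (∀ u v → u ≢ v → vsum G f u ≢ vsum G f v)

-- Star K_{1,s}: vertex 0 is the center, vertices 1..s are leaves
star : ℕ → Graph
star s = record { n = suc s ; adj = λ u v → ((toℕ u ≡ᵇ 0) ∧ (0 <ᵇ toℕ v)) ∨ ((toℕ v ≡ᵇ 0) ∧ (0 <ᵇ toℕ u)) }

path : ℕ → Graph
path k = record { n = k ; adj = λ u v → (suc (toℕ u) ≡ᵇ toℕ v) ∨ (suc (toℕ v) ≡ᵇ toℕ u) }

-- Direct (tensor) product G × H on Fin (n G * n H) ≅ Fin (n G) × Fin (n H)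
open import Data.Fin using (combine; remQuot)

_⊗_ : Graph → Graph → Graph
G ⊗ H = record
  { n = n G * n H
  ; adj = λ p q → let (x , y) = remQuot (n H) p ; (x' , y') = remQuot (n H) q
                  in adj G x x' ∧ adj H y y' }

module Submission where

-- The vertices of K₁,ₛ × P_{K+1} are pairs (x , y), x = 0 being the centre. Every edge joins a
-- centre copy (0 , j) to a leaf copy (x , y), x ≥ 1, with j and y adjacent on the path; label it
-- s · β(j → y) + x, where β numbers the 2K arcs of the path by 0 , … , 2K − 1. By division with
-- remainder by s this is a bijection onto {1 , … , 2Ks}. The leaf copy (x , y) then has vertex sum
-- s · Σ_j β(j → y) + deg(y) · x, and the centre copy (0 , j) has s² · Σ_y β(j → y) + deg(j) · (1 + ⋯ + s).
-- For the chosen β every leaf sum is below every centre sum (this is where s ≥ 3 is needed), the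
-- leaf sums are distinct because Σ_j β(j → y) grows by at least 2 along the inner vertices, and the
-- centre sums because Σ_y β(j → y) separates centres of equal degree while 0 < 1 + ⋯ + s < s² keeps
-- the degree term from interfering.

open import Defs
open import Data.Bool using (Bool; true; false; if_then_else_; _∧_; _∨_; T)
import Data.Bool as Bool
open import Data.Bool.Properties using (∧-zeroʳ; ∧-identityʳ; ∨-comm; ∨-zeroʳ)
open import Data.Fin using (Fin; zero; suc; toℕ; fromℕ<; combine; remQuot; _↑ˡ_; _↑ʳ_)
open import Data.Fin.Properties
  using (_≟_; remQuot-combine; combine-remQuot; toℕ-combine; toℕ<n; toℕ-fromℕ<; toℕ-injective; injective⇒≤)
open import Data.List using (List; []; _∷_; map; filter; length; allFin; cartesianProduct; lookup; tabulate; _++_)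
open import Data.List.Properties using (map-++; map-tabulate; map-∘; map-cong)
open import Data.List.Membership.Propositional using (_∈_)
open import Data.List.Membership.Propositional.Properties
  using (∈-filter⁺; ∈-filter⁻; ∈-cartesianProduct⁺; ∈-allFin; ∈-lookup)
open import Data.List.Relation.Unary.Any using (index)
open import Data.List.Relation.Unary.Any.Properties using (lookup-index)
import Data.List.Relation.Unary.All as All
open import Data.List.Relation.Unary.AllPairs using (_∷_)
open import Data.List.Relation.Unary.Unique.Propositional using (Unique)
import Data.List.Relation.Unary.Unique.Propositional.Properties as Unique
open import Data.Nat hiding (_≟_)
open import Data.Nat.DivMod using (_/_; _%_; m≡m%n+[m/n]*n; m%n<n; m<n*o⇒m/o<n)
open import Data.Nat.ListAction using (sum)
open import Data.Nat.ListAction.Properties using (sum-++)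
open import Data.Nat.Properties hiding (_≟_)
import Data.Nat.Properties as ℕ
open import Algebra.Properties.Semiring.Sum +-*-semiring
  using (sum-syntax; sum-cong-≗; ∑-distrib-+; sum-replicate-zero) renaming (sum to ∑)
open import Data.Nat.Tactic.RingSolver using (solve-∀)
open import Data.Product using (_×_; _,_; proj₁; proj₂; ∃; Σ-syntax; uncurry)
open import Data.Sum using (_⊎_; inj₁; inj₂)
open import Function using (_∘_)
open import Level using (Level)
open import Relation.Binary using (tri<; tri≈; tri>)
open import Relation.Binary.PropositionalEquality
open import Relation.Nullary using (Dec; does; yes; no; contradiction)
open import Relation.Nullary.Decidable using (⌊_⌋)
open import Relation.Unary using (Pred; Decidable)

private
  variable
    ℓ ℓ′ p : Level
    A : Set ℓ
    B : Set ℓ′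

≡ᵇ-sym : ∀ m n → (m ≡ᵇ n) ≡ (n ≡ᵇ m)
≡ᵇ-sym zero    zero    = refl
≡ᵇ-sym zero    (suc n) = refl
≡ᵇ-sym (suc m) zero    = refl
≡ᵇ-sym (suc m) (suc n) = ≡ᵇ-sym m n

≡ᵇ-refl : ∀ n → (n ≡ᵇ n) ≡ true
≡ᵇ-refl zero    = refl
≡ᵇ-refl (suc n) = ≡ᵇ-refl n

2+n≡ᵇn : ∀ n → (suc (suc n) ≡ᵇ n) ≡ false
2+n≡ᵇn zero    = refl
2+n≡ᵇn (suc n) = 2+n≡ᵇn n

≡ᵇ-true⇒≡ : ∀ {m n} → (m ≡ᵇ n) ≡ true → m ≡ n
≡ᵇ-true⇒≡ {m} {n} e = ≡ᵇ⇒≡ m n (subst T (sym e) _)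

≡ᵇ-false : ∀ {m n} → m ≢ n → (m ≡ᵇ n) ≡ false
≡ᵇ-false {m} {n} m≢n with m ≡ᵇ n in e
... | false = refl
... | true  = contradiction (≡ᵇ-true⇒≡ e) m≢n

<ᵇ-irrefl : ∀ n → (n <ᵇ n) ≡ false
<ᵇ-irrefl zero    = refl
<ᵇ-irrefl (suc n) = <ᵇ-irrefl n

<ᵇ-true : ∀ {m n} → m < n → (m <ᵇ n) ≡ true
<ᵇ-true {m} {n} m<n with m <ᵇ n | <⇒<ᵇ m<n
... | true | _ = refl

<ᵇ-false : ∀ {m n} → n ≤ m → (m <ᵇ n) ≡ false
<ᵇ-false {m} {n} n≤m with m <ᵇ n in eq
... | false = refl
... | true  = contradiction (<ᵇ⇒< m n (subst T (sym eq) _)) (≤⇒≯ n≤m)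

does-≟-true : ∀ b → does (b Bool.≟ true) ≡ b
does-≟-true true  = refl
does-≟-true false = refl

if-∨-split : ∀ (e i j : Bool) (x : ℕ) → (i ≡ true → j ≡ true → e ≡ false) →
  (if e then (if i ∨ j then x else 0) else 0) ≡ (if i then (if e then x else 0) else 0) + (if j then (if e then x else 0) else 0)
if-∨-split false false false x _ = refl
if-∨-split false false true  x _ = refl
if-∨-split false true  false x _ = refl
if-∨-split false true  true  x _ = refl
if-∨-split true  false false x _ = refl
if-∨-split true  false true  x _ = refl
if-∨-split true  true  false x _ = sym (+-identityʳ x)
if-∨-split true  true  true  x h with () ← h refl refl

sum-tabulate : ∀ n (f : Fin n → ℕ) → sum (tabulate f) ≡ ∑[ i < n ] f i
sum-tabulate zero    f = refl
sum-tabulate (suc n) f = cong (f zero +_) (sum-tabulate n (λ i → f (suc i)))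

sum-map-allFin : ∀ n (f : Fin n → ℕ) → sum (map f (allFin n)) ≡ ∑[ i < n ] f i
sum-map-allFin n f = trans (cong sum (map-tabulate (λ i → i) f)) (sum-tabulate n f)

∑-lookup : (F : A → ℕ) (xs : List A) → ∑[ i < length xs ] F (lookup xs i) ≡ sum (map F xs)
∑-lookup F []       = refl
∑-lookup F (x ∷ xs) = cong (F x +_) (∑-lookup F xs)

sum-map-filter : {P : Pred A p} (P? : Decidable P) (h : A → ℕ) (xs : List A) →
                 sum (map h (filter P? xs)) ≡ sum (map (λ x → if does (P? x) then h x else 0) xs)
sum-map-filter P? h []       = refl
sum-map-filter P? h (x ∷ xs) with does (P? x)
... | true  = cong (h x +_) (sum-map-filter P? h xs)
... | false = sum-map-filter P? h xs

sum-map-cartesianProduct : (h : A × B → ℕ) (xs : List A) (ys : List B) →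
  sum (map h (cartesianProduct xs ys)) ≡ sum (map (λ x → sum (map (λ y → h (x , y)) ys)) xs)
sum-map-cartesianProduct h []       ys = refl
sum-map-cartesianProduct h (x ∷ xs) ys = begin
  sum (map h (map (x ,_) ys ++ cartesianProduct xs ys))
    ≡⟨ cong sum (map-++ h (map (x ,_) ys) _) ⟩
  sum (map h (map (x ,_) ys) ++ map h (cartesianProduct xs ys))
    ≡⟨ sum-++ (map h (map (x ,_) ys)) _ ⟩
  sum (map h (map (x ,_) ys)) + sum (map h (cartesianProduct xs ys))
    ≡⟨ cong₂ _+_ (cong sum (sym (map-∘ ys))) (sum-map-cartesianProduct h xs ys) ⟩
  sum (map (λ y → h (x , y)) ys) + sum (map (λ x → sum (map (λ y → h (x , y)) ys)) xs)
    ∎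
  where open ≡-Reasoning

∑-zero : ∀ n → ∑[ i < n ] 0 ≡ 0
∑-zero = sum-replicate-zero

∑-if : ∀ n (c : Bool) (f : Fin n → ℕ) → ∑[ i < n ] (if c then f i else 0) ≡ (if c then ∑[ i < n ] f i else 0)
∑-if n true  f = refl
∑-if n false f = ∑-zero n

∑-pointMass : ∀ {n} (v : Fin n) (g : Fin n → ℕ) → ∑[ u < n ] (if ⌊ v ≟ u ⌋ then g u else 0) ≡ g v
∑-pointMass {suc n} zero    g = trans (cong (g zero +_) (∑-zero n)) (+-identityʳ (g zero))
∑-pointMass {suc n} (suc v) g = trans (sum-cong-≗ {n} (λ u → cong (λ c → if c then g (suc u) else 0) (isYes-suc≟suc v u)))
                                       (∑-pointMass v (λ u → g (suc u)))
  where
  isYes-suc≟suc : ∀ {n} (v u : Fin n) → ⌊ suc v ≟ suc u ⌋ ≡ ⌊ v ≟ u ⌋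
  isYes-suc≟suc v u with v ≟ u
  ... | yes _ = refl
  ... | no  _ = refl

∑-↑ : ∀ m n (h : Fin (m + n) → ℕ) → ∑[ i < m + n ] h i ≡ ∑[ i < m ] h (i ↑ˡ n) + ∑[ j < n ] h (m ↑ʳ j)
∑-↑ zero    n h = refl
∑-↑ (suc m) n h = trans (cong (h zero +_) (∑-↑ m n (λ i → h (suc i)))) (sym (+-assoc (h zero) _ _))

∑-combine : ∀ m n (h : Fin (m * n) → ℕ) → ∑[ w < m * n ] h w ≡ ∑[ x < m ] ∑[ y < n ] h (combine x y)
∑-combine zero    n h = refl
∑-combine (suc m) n h = trans (∑-↑ n (m * n) h) (cong (∑[ y < n ] h (y ↑ˡ (m * n)) +_) (∑-combine m n (h ∘ (n ↑ʳ_))))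

∑-pick : ∀ n c (F : ℕ → ℕ) → ∑[ y < n ] (if toℕ y ≡ᵇ c then F (toℕ y) else 0) ≡ (if c <ᵇ n then F c else 0)
∑-pick zero    c       F = refl
∑-pick (suc n) zero    F = trans (cong (F 0 +_) (∑-zero n)) (+-identityʳ (F 0))
∑-pick (suc n) (suc c) F = ∑-pick n c (F ∘ suc)

∑∑-zero : ∀ m n → ∑[ x < m ] ∑[ y < n ] 0 ≡ 0
∑∑-zero m n = trans (sum-cong-≗ {m} (λ _ → ∑-zero n)) (∑-zero m)

∑-const : ∀ n c → ∑[ i < n ] c ≡ n * c
∑-const zero    c = refl
∑-const (suc n) c = cong (c +_) (∑-const n c)

∑-+-const : ∀ n c (f : Fin n → ℕ) → ∑[ i < n ] (c + f i) ≡ n * c + ∑[ i < n ] f i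
∑-+-const n c f = trans (∑-distrib-+ (λ _ → c) f) (cong (_+ ∑[ i < n ] f i) (∑-const n c))

triangle : ℕ → ℕ
triangle n = ∑[ i < n ] suc (toℕ i)

triangle-suc : ∀ n → triangle (suc n) ≡ suc (n + triangle n)
triangle-suc n = cong suc (trans (∑-+-const n 1 (λ i → suc (toℕ i))) (cong (_+ triangle n) (*-identityʳ n)))

n<triangle : ∀ n → 2 ≤ n → n < triangle n
n<triangle (suc n) (s≤s 1≤n) rewrite triangle-suc n = s≤s (m<m+n n (≤-trans 1≤n (n≤triangle n)))
  where
  n≤triangle : ∀ n → n ≤ triangle n
  n≤triangle zero    = z≤n
  n≤triangle (suc n) rewrite triangle-suc n = s≤s (m≤m+n n _)

triangle<square : ∀ n → 2 ≤ n → triangle n < n * n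
triangle<square (suc (suc n)) (s≤s (s≤s z≤n)) = triangle<square′ n
  where
  triangle<square′ : ∀ n → triangle (2 + n) < (2 + n) * (2 + n)
  triangle<square′ zero    = ≤-refl
  triangle<square′ (suc n) rewrite triangle-suc (2 + n) =
    s≤s (+-monoʳ-< (2 + n) (<-≤-trans (triangle<square′ n) (*-monoʳ-≤ (2 + n) (n≤1+n (2 + n)))))

+-double-injective : ∀ {m n} → m + m ≡ n + n → m ≡ n
+-double-injective {m} {n} eq = trans (n≡⌊n+n/2⌋ m) (trans (cong ⌊_/2⌋ eq) (sym (n≡⌊n+n/2⌋ n)))

m+m≡m*2 : ∀ m → m + m ≡ m * 2
m+m≡m*2 = solve-∀

*+-mono-< : ∀ s {q q' r r'} d → r ≤ s * d → 0 < r' → q + d ≤ q' → s * q + r < s * q' + r'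
*+-mono-< s {q} {q'} {r} {r'} d r≤sd 0<r' q+d≤q' = begin-strict
  s * q + r        ≤⟨ +-monoʳ-≤ (s * q) r≤sd ⟩
  s * q + s * d    ≡⟨ sym (*-distribˡ-+ s q d) ⟩
  s * (q + d)      ≤⟨ *-monoʳ-≤ s q+d≤q' ⟩
  s * q'           <⟨ m<m+n (s * q') 0<r' ⟩
  s * q' + r'      ∎
  where open ≤-Reasoning

*+suc-< : ∀ s {q q' r r'} → r < s → q < q' → s * q + suc r < s * q' + suc r'
*+suc-< s {q} r<s q<q' =
  *+-mono-< s 1 (≤-trans r<s (≤-reflexive (sym (*-identityʳ s)))) z<s (≤-trans (≤-reflexive (+-comm q 1)) q<q')

*+suc-injective : ∀ s {q q' r r'} → r < s → r' < s → s * q + suc r ≡ s * q' + suc r' → q ≡ q' × r ≡ r'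
*+suc-injective s {q} {q'} r<s r'<s eq with <-cmp q q'
... | tri< q<q' _ _ = contradiction eq (<⇒≢ (*+suc-< s r<s q<q'))
... | tri> _ _ q>q' = contradiction (sym eq) (<⇒≢ (*+suc-< s r'<s q>q'))
... | tri≈ _ refl _ = refl , suc-injective (+-cancelˡ-≡ (s * q) _ _ eq)

*²+-cancel : ∀ s {x y} t → 0 < s → s * (s * x) + t ≡ s * (s * y) + t → x ≡ y
*²+-cancel s {x} {y} t 0<s eq = *-cancelˡ-≡ x y s {{>-nonZero 0<s}}
  (*-cancelˡ-≡ (s * x) (s * y) s {{>-nonZero 0<s}} (+-cancelʳ-≡ t _ _ eq))

*²+S≢*²+2S : ∀ s {x y S} → 0 < S → S < s * s → s * (s * x) + S ≢ s * (s * y) + (S + S)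
*²+S≢*²+2S s {x} {y} {S} 0<S S<ss eq with x ≤? y
... | yes x≤y = <⇒≢ (+-mono-≤-< (*-monoʳ-≤ s (*-monoʳ-≤ s x≤y)) (m<m+n S 0<S)) eq
... | no  x≰y = <⇒≢ (begin-strict
  s * (s * y) + (S + S)       <⟨ +-monoʳ-< (s * (s * y)) (+-monoˡ-< S S<ss) ⟩
  s * (s * y) + (s * s + S)   ≡⟨ rearrange s y S ⟩
  s * (s * suc y) + S         ≤⟨ +-monoˡ-≤ S (*-monoʳ-≤ s (*-monoʳ-≤ s (≰⇒> x≰y))) ⟩
  s * (s * x) + S             ∎) (sym eq)
  where
  open ≤-Reasoning
  rearrange : ∀ s y S → s * (s * y) + (s * s + S) ≡ s * (s * suc y) + S
  rearrange = solve-∀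

-- Vertex sums of a labelling of the edge list

isEdge : (G : Graph) → V G → V G → Bool
isEdge G u w = adj G u w ∧ (toℕ u <ᵇ toℕ w)

isEdge-irrefl : ∀ G (u : V G) → isEdge G u u ≡ false
isEdge-irrefl G u = trans (cong (adj G u u ∧_) (<ᵇ-irrefl (toℕ u))) (∧-zeroʳ _)

Unique-lookup-injective : {xs : List A} → Unique xs → ∀ i j → lookup xs i ≡ lookup xs j → i ≡ j
Unique-lookup-injective (_   ∷ _) zero    zero    _  = refl
Unique-lookup-injective (x∉ ∷ _) zero    (suc j) eq = contradiction eq (All.lookup x∉ (∈-lookup j))
Unique-lookup-injective (x∉ ∷ _) (suc i) zero    eq = contradiction (sym eq) (All.lookup x∉ (∈-lookup i))
Unique-lookup-injective (_   ∷ u) (suc i) (suc j) eq = cong suc (Unique-lookup-injective u i j eq)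

module _ (G : Graph) where

  isEdge? : (e : V G × V G) → Dec (isEdge G (proj₁ e) (proj₂ e) ≡ true)
  isEdge? e = isEdge G (proj₁ e) (proj₂ e) Bool.≟ true

  edges-unique : Unique (edges G)
  edges-unique = Unique.filter⁺ isEdge? (Unique.cartesianProduct⁺ (Unique.allFin⁺ (n G)) (Unique.allFin⁺ (n G)))

  ∈-edges⁺ : ∀ {u w} → isEdge G u w ≡ true → (u , w) ∈ edges G
  ∈-edges⁺ {u} {w} = ∈-filter⁺ isEdge? (∈-cartesianProduct⁺ (∈-allFin u) (∈-allFin w))

  ∈-edges⁻ : ∀ {u w} → (u , w) ∈ edges G → isEdge G u w ≡ true
  ∈-edges⁻ e∈E = proj₂ (∈-filter⁻ isEdge? {xs = cartesianProduct (verts G) (verts G)} e∈E)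

  sum-edges : (h : V G × V G → ℕ) →
    sum (map h (edges G)) ≡ ∑[ u < n G ] ∑[ w < n G ] (if isEdge G u w then h (u , w) else 0)
  sum-edges h = begin
    sum (map h (edges G))
      ≡⟨ sum-map-filter isEdge? h (cartesianProduct (verts G) (verts G)) ⟩
    sum (map onEdge (cartesianProduct (verts G) (verts G)))
      ≡⟨ sum-map-cartesianProduct onEdge (verts G) (verts G) ⟩
    sum (map (λ u → sum (map (λ w → onEdge (u , w)) (verts G))) (verts G))
      ≡⟨ cong sum (map-cong (λ u → sum-map-allFin (n G) (λ w → onEdge (u , w))) (verts G)) ⟩
    sum (map (λ u → ∑[ w < n G ] onEdge (u , w)) (verts G))
      ≡⟨ sum-map-allFin (n G) (λ u → ∑[ w < n G ] onEdge (u , w)) ⟩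
    ∑[ u < n G ] ∑[ w < n G ] onEdge (u , w)
      ≡⟨ sum-cong-≗ (λ u → sum-cong-≗ (λ w → cong (λ c → if c then h (u , w) else 0) (does-≟-true (isEdge G u w)))) ⟩
    ∑[ u < n G ] ∑[ w < n G ] (if isEdge G u w then h (u , w) else 0)
      ∎
    where
    open ≡-Reasoning
    onEdge : V G × V G → ℕ
    onEdge e = if does (isEdge? e) then h e else 0

  vsum-pairLabelling : (lab : V G × V G → ℕ) (v : V G) →
    vsum G (lab ∘ lookup (edges G)) v ≡
      ∑[ w < n G ] (if isEdge G v w then lab (v , w) else 0) + ∑[ u < n G ] (if isEdge G u v then lab (u , v) else 0)
  vsum-pairLabelling lab v = begin
    vsum G (lab ∘ lookup (edges G)) v
      ≡⟨ sum-map-allFin (|E| G) (λ i → atV (lookup (edges G) i)) ⟩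
    ∑[ i < |E| G ] atV (lookup (edges G) i)
      ≡⟨ ∑-lookup atV (edges G) ⟩
    sum (map atV (edges G))
      ≡⟨ sum-edges atV ⟩
    ∑[ u < n G ] ∑[ w < n G ] (if isEdge G u w then atV (u , w) else 0)
      ≡⟨ sum-cong-≗ (λ u → trans (sum-cong-≗ (split u)) (∑-distrib-+ (λ w → out u w) (λ w → into u w))) ⟩
    ∑[ u < n G ] (∑[ w < n G ] out u w + ∑[ w < n G ] into u w)
      ≡⟨ ∑-distrib-+ (λ u → ∑[ w < n G ] out u w) (λ u → ∑[ w < n G ] into u w) ⟩
    ∑[ u < n G ] ∑[ w < n G ] out u w + ∑[ u < n G ] ∑[ w < n G ] into u w
      ≡⟨ cong₂ _+_ (trans (sum-cong-≗ (λ u → ∑-if (n G) ⌊ v ≟ u ⌋ (edgeLabel u)))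
                          (∑-pointMass v (λ u → ∑[ w < n G ] edgeLabel u w)))
                   (sum-cong-≗ (λ u → ∑-pointMass v (edgeLabel u))) ⟩
    ∑[ w < n G ] edgeLabel v w + ∑[ u < n G ] edgeLabel u v
      ∎
    where
    open ≡-Reasoning
    atV : V G × V G → ℕ
    atV e = if incident G v e then lab e else 0
    edgeLabel : V G → V G → ℕ
    edgeLabel u w = if isEdge G u w then lab (u , w) else 0
    out into : V G → V G → ℕ
    out  u w = if ⌊ v ≟ u ⌋ then edgeLabel u w else 0
    into u w = if ⌊ v ≟ w ⌋ then edgeLabel u w else 0
    loopless : ∀ u w → ⌊ v ≟ u ⌋ ≡ true → ⌊ v ≟ w ⌋ ≡ true → isEdge G u w ≡ false
    loopless u w p  q  with v ≟ u | v ≟ w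
    loopless u w p  q  | yes refl | yes refl = isEdge-irrefl G v
    loopless u w () q  | no _     | _
    loopless u w p  () | yes _    | no _
    split : ∀ u w → (if isEdge G u w then atV (u , w) else 0) ≡ out u w + into u w
    split u w = if-∨-split (isEdge G u w) ⌊ v ≟ u ⌋ ⌊ v ≟ w ⌋ (lab (u , w)) (loopless u w)

  -- |E| = L follows by counting: edges and labels inject into each other.
  isBijLabel-fromEdges : (lab : V G × V G → ℕ) (L : ℕ) →
    (∀ {e} → e ∈ edges G → 1 ≤ lab e × lab e ≤ L) →
    (∀ {e e'} → e ∈ edges G → e' ∈ edges G → lab e ≡ lab e' → e ≡ e') →
    (∀ l → 1 ≤ l → l ≤ L → ∃ λ e → e ∈ edges G × lab e ≡ l) →
    IsBijLabel G (lab ∘ lookup (edges G))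
  isBijLabel-fromEdges lab L range injective surjective =
    (λ i → proj₁ (range′ i) , subst (f i ≤_) (sym |E|≡L) (proj₂ (range′ i))) ,
    f-injective ,
    (λ l 1≤l l≤|E| → labelled l 1≤l (subst (l ≤_) |E|≡L l≤|E|))
    where
    f : Labelling G
    f = lab ∘ lookup (edges G)
    range′ : ∀ i → 1 ≤ f i × f i ≤ L
    range′ i = range (∈-lookup i)
    f-injective : ∀ i j → f i ≡ f j → i ≡ j
    f-injective i j eq = Unique-lookup-injective edges-unique i j (injective (∈-lookup i) (∈-lookup j) eq)
    labelled : ∀ l → 1 ≤ l → l ≤ L → ∃ λ i → f i ≡ l
    labelled l 1≤l l≤L with surjective l 1≤l l≤L
    ... | e , e∈E , lab-e≡l = index e∈E , trans (cong lab (sym (lookup-index e∈E))) lab-e≡l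
    pred< : ∀ {x} → 1 ≤ x → x ≤ L → pred x < L
    pred< {suc x} _ x<L = x<L
    toLabel : Fin (|E| G) → Fin L
    toLabel i = fromℕ< (pred< (proj₁ (range′ i)) (proj₂ (range′ i)))
    toLabel-injective : ∀ {i j} → toLabel i ≡ toLabel j → i ≡ j
    toLabel-injective {i} {j} eq = f-injective i j
      (pred-injective {{>-nonZero (proj₁ (range′ i))}} {{>-nonZero (proj₁ (range′ j))}}
        (trans (sym (toℕ-fromℕ< _)) (trans (cong toℕ eq) (toℕ-fromℕ< _))))
    fromLabel : Fin L → Fin (|E| G)
    fromLabel t = proj₁ (labelled (suc (toℕ t)) (s≤s z≤n) (toℕ<n t))
    fromLabel-injective : ∀ {t t'} → fromLabel t ≡ fromLabel t' → t ≡ t'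
    fromLabel-injective {t} {t'} eq = toℕ-injective (suc-injective
      (trans (sym (proj₂ (labelled _ _ _))) (trans (cong f eq) (proj₂ (labelled _ _ _)))))
    |E|≡L : |E| G ≡ L
    |E|≡L = ≤-antisym (injective⇒≤ toLabel-injective) (injective⇒≤ fromLabel-injective)

-- Direct products with a star

∑-⊗ : (G H : Graph) (h : V (G ⊗ H) → ℕ) → ∑[ w < n (G ⊗ H) ] h w ≡ ∑[ x < n G ] ∑[ y < n H ] h (combine x y)
∑-⊗ G H = ∑-combine (n G) (n H)

isEdge-⊗ : (G H : Graph) (x x' : V G) (y y' : V H) →
  isEdge (G ⊗ H) (combine x y) (combine x' y')
    ≡ (adj G x x' ∧ adj H y y') ∧ (n H * toℕ x + toℕ y <ᵇ n H * toℕ x' + toℕ y')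
isEdge-⊗ G H x x' y y' = cong₂ _∧_
  (cong₂ (λ p q → adj G (proj₁ p) (proj₁ q) ∧ adj H (proj₂ p) (proj₂ q))
         (remQuot-combine {n G} {n H} x y) (remQuot-combine x' y'))
  (cong₂ _<ᵇ_ (toℕ-combine x y) (toℕ-combine x' y'))

centreToLeaf : ∀ {s} → Fin (suc s) → Fin (suc s) → Bool
centreToLeaf zero (suc _) = true
centreToLeaf _    _       = false

centreToLeaf-zero : ∀ {s} (x : Fin (suc s)) → centreToLeaf x zero ≡ false
centreToLeaf-zero zero    = refl
centreToLeaf-zero (suc x) = refl

isEdge-star⊗ : ∀ s (H : Graph) (x x' : Fin (suc s)) (y y' : V H) →
  isEdge (star s ⊗ H) (combine x y) (combine x' y') ≡ centreToLeaf x x' ∧ adj H y y'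
isEdge-star⊗ s H x x' y y' rewrite isEdge-⊗ (star s) H x x' y y' = byStarCoordinates x x'
  where
  m : ℕ
  m = n H
  byStarCoordinates : ∀ (x x' : Fin (suc s)) →
       (adj (star s) x x' ∧ adj H y y') ∧ (m * toℕ x + toℕ y <ᵇ m * toℕ x' + toℕ y') ≡ centreToLeaf x x' ∧ adj H y y'
  byStarCoordinates zero    zero     = refl
  byStarCoordinates zero    (suc x') = trans (cong (adj H y y' ∧_) (<ᵇ-true (begin-strict
      m * 0 + toℕ y  ≡⟨ cong (_+ toℕ y) (*-zeroʳ m) ⟩
      toℕ y          <⟨ toℕ<n y ⟩
      m              ≤⟨ m≤m*n m (suc (toℕ x')) ⟩
      m * suc (toℕ x')  ≤⟨ m≤m+n _ (toℕ y') ⟩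
      m * suc (toℕ x') + toℕ y'  ∎))) (∧-identityʳ _)
    where open ≤-Reasoning
  byStarCoordinates (suc x) zero     = trans (cong (adj H y y' ∧_) (<ᵇ-false (begin
      m * 0 + toℕ y'  ≡⟨ cong (_+ toℕ y') (*-zeroʳ m) ⟩
      toℕ y'          ≤⟨ <⇒≤ (toℕ<n y') ⟩
      m               ≤⟨ m≤m*n m (suc (toℕ x)) ⟩
      m * suc (toℕ x) ≤⟨ m≤m+n _ (toℕ y) ⟩
      m * suc (toℕ x) + toℕ y  ∎))) (∧-zeroʳ _)
    where open ≤-Reasoning
  byStarCoordinates (suc x) (suc x') = refl

-- The edge joining the centre copy (0 , j) to the leaf copy (x , y) gets the label s · β j y + x.
starLabel : ∀ s (H : Graph) → (V H → V H → ℕ) → V (star s ⊗ H) × V (star s ⊗ H) → ℕ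
starLabel s H β (u , w) =
  s * β (proj₂ (remQuot {suc s} (n H) u)) (proj₂ (remQuot {suc s} (n H) w)) + toℕ (proj₁ (remQuot {suc s} (n H) w))

module StarProduct (s : ℕ) (H : Graph) (β : V H → V H → ℕ) where

  G : Graph
  G = star s ⊗ H

  f : Labelling G
  f = starLabel s H β ∘ lookup (edges G)

  vertex : Fin (suc s) → V H → V G
  vertex = combine

  starLabel-combine : ∀ (x x' : Fin (suc s)) (j y : V H) → starLabel s H β (combine x j , combine x' y) ≡ s * β j y + toℕ x'
  starLabel-combine x x' j y = cong₂ (λ p q → s * β (proj₂ p) (proj₂ q) + toℕ (proj₁ q))
                                     (remQuot-combine {suc s} {n H} x j) (remQuot-combine x' y)

  vsum-combine : ∀ a b → vsum G f (vertex a b) ≡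
      ∑[ x < suc s ] ∑[ y < n H ] (if centreToLeaf a x ∧ adj H b y then s * β b y + toℕ x else 0)
    + ∑[ x < suc s ] ∑[ j < n H ] (if centreToLeaf x a ∧ adj H j b then s * β j b + toℕ a else 0)
  vsum-combine a b = trans (vsum-pairLabelling G (starLabel s H β) (vertex a b)) (cong₂ _+_
    (trans (∑-⊗ (star s) H _) (sum-cong-≗ (λ x → sum-cong-≗ (λ y →
       cong₂ (λ e l → if e then l else 0) (isEdge-star⊗ s H a x b y) (starLabel-combine a x b y)))))
    (trans (∑-⊗ (star s) H _) (sum-cong-≗ (λ x → sum-cong-≗ (λ j →
       cong₂ (λ e l → if e then l else 0) (isEdge-star⊗ s H x a j b) (starLabel-combine x a j b))))))

  vsum-centre : ∀ b → vsum G f (vertex zero b) ≡ ∑[ x < s ] ∑[ y < n H ] (if adj H b y then s * β b y + suc (toℕ x) else 0)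
  vsum-centre b = begin
    vsum G f (vertex zero b)              ≡⟨ vsum-combine zero b ⟩
    (∑[ y < n H ] 0 + outgoing) + incoming ≡⟨ cong₂ (λ z i → z + outgoing + i) (∑-zero (n H)) noIncoming ⟩
    outgoing + 0                          ≡⟨ +-identityʳ outgoing ⟩
    outgoing                              ∎
    where
    open ≡-Reasoning
    outgoing incoming : ℕ
    outgoing = ∑[ x < s ] ∑[ y < n H ] (if adj H b y then s * β b y + suc (toℕ x) else 0)
    incoming = ∑[ x < suc s ] ∑[ j < n H ] (if centreToLeaf x zero ∧ adj H j b then s * β j b + 0 else 0)
    noIncoming : incoming ≡ 0
    noIncoming = trans (sum-cong-≗ {suc s} (λ x → sum-cong-≗ (λ j →
      cong (λ c → if c ∧ adj H j b then s * β j b + 0 else 0) (centreToLeaf-zero x)))) (∑∑-zero (suc s) (n H))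

  vsum-leaf : ∀ a b → vsum G f (vertex (suc a) b) ≡ ∑[ j < n H ] (if adj H j b then s * β j b + suc (toℕ a) else 0)
  vsum-leaf a b = begin
    vsum G f (vertex (suc a) b)                                   ≡⟨ vsum-combine (suc a) b ⟩
    ∑[ x < suc s ] ∑[ y < n H ] 0 + (incoming + ∑[ x < s ] ∑[ j < n H ] 0)
      ≡⟨ cong₂ (λ o z → o + (incoming + z)) (∑∑-zero (suc s) (n H)) (∑∑-zero s (n H)) ⟩
    incoming + 0                                                  ≡⟨ +-identityʳ incoming ⟩
    incoming                                                      ∎
    where
    open ≡-Reasoning
    incoming : ℕ
    incoming = ∑[ j < n H ] (if adj H j b then s * β j b + suc (toℕ a) else 0)

  data Spoke : V G × V G → Set where
    spoke : ∀ j (x : Fin s) y → adj H j y ≡ true → Spoke (vertex zero j , vertex (suc x) y)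

  spoke-∈ : ∀ j (x : Fin s) y → adj H j y ≡ true → (vertex zero j , vertex (suc x) y) ∈ edges G
  spoke-∈ j x y j~y = ∈-edges⁺ G (trans (isEdge-star⊗ s H zero (suc x) j y) j~y)

  ∈⇒Spoke : ∀ {e} → e ∈ edges G → Spoke e
  ∈⇒Spoke {u , w} e∈E = view (remQuot (n H) u) (remQuot (n H) w)
                             (combine-remQuot {suc s} (n H) u) (combine-remQuot {suc s} (n H) w) (∈-edges⁻ G e∈E)
    where
    view : ∀ {u w} (p q : Fin (suc s) × V H) → uncurry vertex p ≡ u → uncurry vertex q ≡ w →
           isEdge G u w ≡ true → Spoke (u , w)
    view (zero  , j) (suc x , y) refl refl e = spoke j x y (trans (sym (isEdge-star⊗ s H zero (suc x) j y)) e)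
    view (zero  , j) (zero  , y) refl refl e with () ← trans (sym (isEdge-star⊗ s H zero zero j y)) e
    view (suc a , j) (x′    , y) refl refl e with () ← trans (sym (isEdge-star⊗ s H (suc a) x′ j y)) e

  starLabel-spoke : ∀ j (x : Fin s) y → starLabel s H β (vertex zero j , vertex (suc x) y) ≡ s * β j y + suc (toℕ x)
  starLabel-spoke j x y = starLabel-combine zero (suc x) j y

-- Paths

atPred : ℕ → (ℕ → ℕ) → ℕ
atPred zero    F = 0
atPred (suc b) F = F b

∑-path-adj : ∀ N b (F : ℕ → ℕ) → b < N →
  ∑[ y < N ] (if (suc b ≡ᵇ toℕ y) ∨ (suc (toℕ y) ≡ᵇ b) then F (toℕ y) else 0)
    ≡ (if suc b <ᵇ N then F (suc b) else 0) + atPred b F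
∑-path-adj N b F b<N = begin
  ∑[ y < N ] (if (suc b ≡ᵇ toℕ y) ∨ (suc (toℕ y) ≡ᵇ b) then F (toℕ y) else 0)
    ≡⟨ sum-cong-≗ {N} (λ y → if-∨-split true _ _ (F (toℕ y)) (noBacktrack (toℕ y))) ⟩
  ∑[ y < N ] (viaSuc y + viaPred y)               ≡⟨ ∑-distrib-+ viaSuc viaPred ⟩
  ∑[ y < N ] viaSuc y + ∑[ y < N ] viaPred y      ≡⟨ cong₂ _+_ successor (predecessor b b<N) ⟩
  (if suc b <ᵇ N then F (suc b) else 0) + atPred b F  ∎
  where
  open ≡-Reasoning
  viaSuc viaPred : Fin N → ℕ
  viaSuc  y = if suc b ≡ᵇ toℕ y then F (toℕ y) else 0
  viaPred y = if suc (toℕ y) ≡ᵇ b then F (toℕ y) else 0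
  noBacktrack : ∀ y → (suc b ≡ᵇ y) ≡ true → (suc y ≡ᵇ b) ≡ true → true ≡ false
  noBacktrack y p q with refl ← ≡ᵇ-true⇒≡ {suc b} {y} p = trans (sym q) (2+n≡ᵇn b)
  successor : ∑[ y < N ] viaSuc y ≡ (if suc b <ᵇ N then F (suc b) else 0)
  successor = trans (sum-cong-≗ {N} (λ y → cong (λ c → if c then F (toℕ y) else 0) (≡ᵇ-sym (suc b) (toℕ y))))
                    (∑-pick N (suc b) F)
  predecessor : ∀ b → b < N → ∑[ y < N ] (if suc (toℕ y) ≡ᵇ b then F (toℕ y) else 0) ≡ atPred b F
  predecessor zero    _     = ∑-zero N
  predecessor (suc c) c+1<N = trans (∑-pick N c F) (cong (λ t → if t then F c else 0) (<ᵇ-true (<-trans (n<1+n c) c+1<N)))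

data Position (K : ℕ) : ℕ → Set where
  first : Position K 0
  last  : Position K K
  inner : ∀ {c} → suc c < K → Position K (suc c)

position : ∀ {K b} → b ≤ K → Position K b
position {b = zero}  _     = first
position {K} {suc c} c+1≤K with suc c ℕ.≟ K
... | yes refl = last
... | no  c+1≢K = inner (≤∧≢⇒< c+1≤K c+1≢K)

data Arc : ℕ → ℕ → Set where
  up   : ∀ j → Arc j (suc j)
  down : ∀ y → Arc (suc y) y

Arc-fromAdj : ∀ j y → ((suc j ≡ᵇ y) ∨ (suc y ≡ᵇ j)) ≡ true → Arc j y
Arc-fromAdj j y adj with suc j ≡ᵇ y in e
... | true  with refl ← ≡ᵇ-true⇒≡ {suc j} {y} e = up j
... | false with refl ← ≡ᵇ-true⇒≡ {suc y} {j} adj = down y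

Arc-adj : ∀ {j y} → Arc j y → ((suc j ≡ᵇ y) ∨ (suc y ≡ᵇ j)) ≡ true
Arc-adj (up j)   = cong (_∨ (suc (suc j) ≡ᵇ j)) (≡ᵇ-refl j)
Arc-adj (down y) = trans (cong ((suc (suc y) ≡ᵇ y) ∨_) (≡ᵇ-refl y)) (∨-zeroʳ _)

-- The path has vertices 0 , … , K; writing K = 3 + k lets comparisons of K with 1 and 2 compute.
module PathArcs (k : ℕ) where

  K : ℕ
  K = 3 + k

  -- Arcs are labelled bijectively by 0 , … , 2K − 1; the arcs 1 → 0 and K − 1 → K into the two ends
  -- get the labels 0 and 1, which keeps the vertex sums of the two degree-one leaf columns smallest.
  upLabel : ℕ → ℕ
  upLabel j = if suc j ≡ᵇ K then 1 else K + suc j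

  downLabel : ℕ → ℕ
  downLabel j = if j ≡ᵇ 1 then 0 else j

  arcLabel : ℕ → ℕ → ℕ
  arcLabel j y = if suc j ≡ᵇ y then upLabel j else downLabel j

  label : ∀ {j y} → Arc j y → ℕ
  label (up j)   = upLabel j
  label (down y) = downLabel (suc y)

  arcLabel-up : ∀ j → arcLabel j (suc j) ≡ upLabel j
  arcLabel-up j = cong (λ c → if c then upLabel j else downLabel j) (≡ᵇ-refl j)

  arcLabel-down : ∀ y → arcLabel (suc y) y ≡ downLabel (suc y)
  arcLabel-down y = cong (λ c → if c then upLabel (suc y) else downLabel (suc y)) (2+n≡ᵇn y)

  arcLabel-label : ∀ {j y} (a : Arc j y) → arcLabel j y ≡ label a
  arcLabel-label (up j)   = arcLabel-up j
  arcLabel-label (down y) = arcLabel-down y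

  upLabel-last : upLabel (2 + k) ≡ 1
  upLabel-last = cong (λ c → if c then 1 else K + K) (≡ᵇ-refl k)

  upLabel-inner : ∀ {j} → suc j < K → upLabel j ≡ K + suc j
  upLabel-inner {j} j+1<K = cong (λ c → if c then 1 else K + suc j) (≡ᵇ-false (<⇒≢ j+1<K))

  upLabel-cases : ∀ j → suc j ≤ K → (suc j ≡ K × upLabel j ≡ 1) ⊎ (suc j < K × upLabel j ≡ K + suc j)
  upLabel-cases j j+1≤K with suc j ℕ.≟ K
  ... | yes refl   = inj₁ (refl , upLabel-last)
  ... | no  j+1≢K = let j+1<K = ≤∧≢⇒< j+1≤K j+1≢K in inj₂ (j+1<K , upLabel-inner j+1<K)

  upLabel-injective : ∀ {j j'} → suc j ≤ K → suc j' ≤ K → upLabel j ≡ upLabel j' → j ≡ j'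
  upLabel-injective {j} {j'} j+1≤K j'+1≤K eq with upLabel-cases j j+1≤K | upLabel-cases j' j'+1≤K
  ... | inj₁ (e , _)      | inj₁ (e' , _)      = suc-injective (trans e (sym e'))
  ... | inj₁ (_ , l)      | inj₂ (_ , l')      with () ← trans (sym l) (trans eq l')
  ... | inj₂ (_ , l)      | inj₁ (_ , l')      with () ← trans (sym l) (trans eq l')
  ... | inj₂ (_ , l)      | inj₂ (_ , l')      = suc-injective (+-cancelˡ-≡ K _ _ (trans (sym l) (trans eq l')))

  upLabel≢downLabel : ∀ {j y} → suc j ≤ K → suc y ≤ K → upLabel j ≢ downLabel (suc y)
  upLabel≢downLabel {j} {y} j+1≤K y+1≤K eq with upLabel-cases j j+1≤K | y
  ... | inj₁ (_ , l) | zero  with () ← trans (sym l) eq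
  ... | inj₁ (_ , l) | suc _ with () ← trans (sym l) eq
  ... | inj₂ (_ , l) | zero  with () ← trans (sym l) eq
  ... | inj₂ (_ , l) | suc _ = <⇒≱ (m<m+n K z<s) (≤-trans (≤-reflexive (trans (sym l) eq)) y+1≤K)

  label-injective : ∀ {j y j' y'} (a : Arc j y) (a' : Arc j' y') → j ≤ K → y ≤ K → j' ≤ K → y' ≤ K →
                    label a ≡ label a' → j ≡ j' × y ≡ y'
  label-injective (up j)   (up j')   _ y≤K _ y'≤K eq = let j≡j' = upLabel-injective y≤K y'≤K eq in j≡j' , cong suc j≡j'
  label-injective (up j)   (down y') _ y≤K j'≤K _ eq = contradiction eq (upLabel≢downLabel y≤K j'≤K)
  label-injective (down y) (up j')   j≤K _ _ y'≤K eq = contradiction (sym eq) (upLabel≢downLabel y'≤K j≤K)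
  label-injective (down zero)    (down zero)     _ _ _ _ eq = refl , refl
  label-injective (down (suc y)) (down (suc y')) _ _ _ _ refl = refl , refl

  label<2K : ∀ {j y} (a : Arc j y) → j ≤ K → y ≤ K → label a < K + K
  label<2K (up j) _ y≤K with upLabel-cases j y≤K
  ... | inj₁ (_ , l)     rewrite l = s≤s (s≤s z≤n)
  ... | inj₂ (j+1<K , l) rewrite l = +-monoʳ-< K j+1<K
  label<2K (down zero)    _   _ = z<s
  label<2K (down (suc y)) j≤K _ = ≤-<-trans j≤K (m<m+n K z<s)

  label-surjective : ∀ q → q < K + K → Σ[ (j , y) ∈ ℕ × ℕ ] Σ[ a ∈ Arc j y ] (j ≤ K × y ≤ K × label a ≡ q)
  label-surjective zero          _ = (1 , 0) , down 0 , s≤s z≤n , z≤n , refl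
  label-surjective (suc zero)    _ = (2 + k , K) , up (2 + k) , n≤1+n _ , ≤-refl , upLabel-last
  label-surjective (suc (suc r)) q<2K with suc (suc r) ≤? K
  ... | yes q≤K = (2 + r , 1 + r) , down (suc r) , q≤K , ≤-trans (n≤1+n _) q≤K , refl
  ... | no  q≰K with m≤n⇒∃[o]m+o≡n (≰⇒> q≰K)
  ...   | o , K+1+o≡q = (o , suc o) , up o , <⇒≤ (<-trans (n<1+n o) o+1<K) , <⇒≤ o+1<K ,
                        trans (upLabel-inner o+1<K) K+o+1≡q
    where
    K+o+1≡q : K + suc o ≡ suc (suc r)
    K+o+1≡q = trans (+-suc K o) K+1+o≡q
    o+1<K : suc o < K
    o+1<K = +-cancelˡ-< K (suc o) K (subst (_< K + K) (sym K+o+1≡q) q<2K)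

  neighbours : ∀ {b} → Position K b → (ℕ → ℕ) → ℕ
  neighbours first         F = F 1
  neighbours last          F = F (2 + k)
  neighbours (inner {c} _) F = F (suc (suc c)) + F c

  Position⇒≤ : ∀ {b} → Position K b → b ≤ K
  Position⇒≤ first         = z≤n
  Position⇒≤ last          = ≤-refl
  Position⇒≤ (inner c+1<K) = <⇒≤ c+1<K

  ∑-neighbours : ∀ {b} (p : Position K b) (F : ℕ → ℕ) →
    ∑[ y < suc K ] (if (suc b ≡ᵇ toℕ y) ∨ (suc (toℕ y) ≡ᵇ b) then F (toℕ y) else 0) ≡ neighbours p F
  ∑-neighbours p F = trans (∑-path-adj (suc K) _ F (s≤s (Position⇒≤ p))) (evaluate p)
    where
    evaluate : ∀ {b} (p : Position K b) → (if suc b <ᵇ suc K then F (suc b) else 0) + atPred b F ≡ neighbours p F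
    evaluate first             = +-identityʳ (F 1)
    evaluate last              = cong (λ c → (if c then F (suc K) else 0) + F (2 + k)) (<ᵇ-irrefl (suc K))
    evaluate (inner {c} c+1<K) = cong (λ t → (if t then F (suc (suc c)) else 0) + F c) (<ᵇ-true (s≤s c+1<K))

module StarPathLabelling (s k : ℕ) (3≤s : 3 ≤ s) where

  open PathArcs k

  N : ℕ
  N = suc K

  β : Fin N → Fin N → ℕ
  β j y = arcLabel (toℕ j) (toℕ y)

  open StarProduct s (path N) β

  S : ℕ
  S = triangle s

  0<s : 0 < s
  0<s = ≤-trans (s≤s z≤n) 3≤s

  2≤s : 2 ≤ s
  2≤s = ≤-trans (s≤s (s≤s z≤n)) 3≤s

  instance
    s-nonZero : NonZero s
    s-nonZero = >-nonZero 0<s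

  leafValue : ∀ {b} → Position K b → ℕ → ℕ
  leafValue first         a = a
  leafValue last          a = s + a
  leafValue (inner {c} _) a = s * (suc (suc c) + (K + suc c)) + (a + a)

  centreValue : ∀ {b} → Position K b → ℕ
  centreValue first         = s * (s * (K + 1)) + S
  centreValue last          = s * (s * K) + S
  centreValue (inner {c} _) = s * (s * (upLabel (suc c) + downLabel (suc c))) + (S + S)

  leafValue-neighbours : ∀ {b} (p : Position K b) a → neighbours p (λ j → s * arcLabel j b + a) ≡ leafValue p a
  leafValue-neighbours first             a = cong (_+ a) (*-zeroʳ s)
  leafValue-neighbours last              a =
    cong (_+ a) (trans (cong (s *_) (trans (arcLabel-up (2 + k)) upLabel-last)) (*-identityʳ s))
  leafValue-neighbours (inner {c} c+1<K) a =
    trans (cong₂ (λ d u → s * d + a + (s * u + a)) (arcLabel-down (suc c)) (trans (arcLabel-up c) (upLabel-inner c+1<K)))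
          (collect s (suc (suc c)) (K + suc c) a)
    where
    collect : ∀ s x y a → s * x + a + (s * y + a) ≡ s * (x + y) + (a + a)
    collect = solve-∀

  centreValue-neighbours : ∀ {b} (p : Position K b) →
                           ∑[ x < s ] neighbours p (λ y → s * arcLabel b y + suc (toℕ x)) ≡ centreValue p
  centreValue-neighbours first             = ∑-+-const s (s * (K + 1)) (λ x → suc (toℕ x))
  centreValue-neighbours last              =
    trans (sum-cong-≗ {s} (λ x → cong (λ l → s * l + suc (toℕ x)) (arcLabel-down (2 + k))))
          (∑-+-const s (s * K) (λ x → suc (toℕ x)))
  centreValue-neighbours (inner {c} c+1<K) = begin
    ∑[ x < s ] (s * arcLabel (suc c) (suc (suc c)) + suc (toℕ x) + (s * arcLabel (suc c) c + suc (toℕ x)))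
      ≡⟨ sum-cong-≗ {s} (λ x → cong₂ (λ u d → s * u + suc (toℕ x) + (s * d + suc (toℕ x)))
                                     (arcLabel-up (suc c)) (arcLabel-down c)) ⟩
    ∑[ x < s ] (s * u + suc (toℕ x) + (s * d + suc (toℕ x)))
      ≡⟨ ∑-distrib-+ {s} (λ x → s * u + suc (toℕ x)) (λ x → s * d + suc (toℕ x)) ⟩
    ∑[ x < s ] (s * u + suc (toℕ x)) + ∑[ x < s ] (s * d + suc (toℕ x))
      ≡⟨ cong₂ _+_ (∑-+-const s (s * u) (λ x → suc (toℕ x))) (∑-+-const s (s * d) (λ x → suc (toℕ x))) ⟩
    s * (s * u) + S + (s * (s * d) + S)
      ≡⟨ collect s u d S ⟩
    s * (s * (u + d)) + (S + S)
      ∎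
    where
    open ≡-Reasoning
    u d : ℕ
    u = upLabel (suc c)
    d = downLabel (suc c)
    collect : ∀ s u d S → s * (s * u) + S + (s * (s * d) + S) ≡ s * (s * (u + d)) + (S + S)
    collect = solve-∀

  position-of : (b : Fin N) → Position K (toℕ b)
  position-of b = position (≤-pred (toℕ<n b))

  vertexSum : Fin (suc s) → Fin N → ℕ
  vertexSum zero    b = centreValue (position-of b)
  vertexSum (suc a) b = leafValue (position-of b) (suc (toℕ a))

  vsum-vertex : ∀ a b → vsum G f (vertex a b) ≡ vertexSum a b
  vsum-vertex zero    b = trans (vsum-centre b)
    (trans (sum-cong-≗ {s} (λ x → ∑-neighbours (position-of b) (λ y → s * arcLabel (toℕ b) y + suc (toℕ x))))
           (centreValue-neighbours (position-of b)))
  vsum-vertex (suc a) b = trans (vsum-leaf a b)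
    (trans (sum-cong-≗ {N} (λ j → cong (λ c → if c then s * β j b + suc (toℕ a) else 0)
                                       (∨-comm (suc (toℕ j) ≡ᵇ toℕ b) (suc (toℕ b) ≡ᵇ toℕ j))))
    (trans (∑-neighbours (position-of b) (λ j → s * arcLabel j (toℕ b) + suc (toℕ a)))
           (leafValue-neighbours (position-of b) (suc (toℕ a)))))

  leafRank : ∀ {b} → Position K b → ℕ
  leafRank first         = 0
  leafRank last          = 1
  leafRank (inner {c} _) = 2 + c

  <leafValue-inner : ∀ {c} (h : suc c < K) {r a} → r ≤ s + s → 1 ≤ a → r < leafValue (inner h) a
  <leafValue-inner h {r} {a} r≤2s 1≤a = subst (_< leafValue (inner h) a) (cong (_+ r) (*-zeroʳ s))
    (*+-mono-< s 2 (≤-trans r≤2s (≤-reflexive (m+m≡m*2 s))) (≤-trans 1≤a (m≤m+n a a)) (s≤s (s≤s z≤n)))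

  leafValue-< : ∀ {b b'} (p : Position K b) (p' : Position K b') {a a'} →
                leafRank p < leafRank p' → a ≤ s → 1 ≤ a' → leafValue p a < leafValue p' a'
  leafValue-< first         last           _                   a≤s 1≤a' = ≤-<-trans a≤s (m<m+n s 1≤a')
  leafValue-< first         (inner h)      _                   a≤s 1≤a' = <leafValue-inner h (≤-trans a≤s (m≤m+n s s)) 1≤a'
  leafValue-< last          (inner h)      _                   a≤s 1≤a' = <leafValue-inner h (+-monoʳ-≤ s a≤s) 1≤a'
  leafValue-< (inner {c} _) (inner {c'} _) {a} {a'} (s≤s (s≤s c<c')) a≤s 1≤a' =
    *+-mono-< s 2 (≤-trans (+-mono-≤ a≤s a≤s) (≤-reflexive (m+m≡m*2 s))) (≤-trans 1≤a' (m≤m+n a' a'))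
      (≤-trans (≤-reflexive (shift c K)) (+-mono-≤ (s≤s (s≤s c<c')) (+-monoʳ-≤ K (s≤s c<c'))))
    where
    shift : ∀ c K → suc (suc c) + (K + suc c) + 2 ≡ suc (suc (suc c)) + (K + suc (suc c))
    shift = solve-∀
  leafValue-< first     first ()
  leafValue-< last      first ()
  leafValue-< last      last  (s≤s ())
  leafValue-< (inner _) first ()
  leafValue-< (inner _) last  (s≤s ())

  leafValue-cancel : ∀ {b b'} (p : Position K b) (p' : Position K b') {a a'} →
                     leafRank p ≡ leafRank p' → leafValue p a ≡ leafValue p' a' → b ≡ b' × a ≡ a'
  leafValue-cancel first     first     _    eq = refl , eq
  leafValue-cancel last      last      _    eq = refl , +-cancelˡ-≡ s _ _ eq
  leafValue-cancel (inner _) (inner _) refl eq = refl , +-double-injective (+-cancelˡ-≡ (s * _) _ _ eq)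
  leafValue-cancel first     last      ()
  leafValue-cancel first     (inner _) ()
  leafValue-cancel last      first     ()
  leafValue-cancel last      (inner _) ()
  leafValue-cancel (inner _) first     ()
  leafValue-cancel (inner _) last      ()

  leafValue-injective : ∀ {b b'} (p : Position K b) (p' : Position K b') {a a'} → 1 ≤ a → a ≤ s → 1 ≤ a' → a' ≤ s →
                        leafValue p a ≡ leafValue p' a' → b ≡ b' × a ≡ a'
  leafValue-injective p p' 1≤a a≤s 1≤a' a'≤s eq with <-cmp (leafRank p) (leafRank p')
  ... | tri< p<p' _ _ = contradiction eq (<⇒≢ (leafValue-< p p' p<p' a≤s 1≤a'))
  ... | tri≈ _ p≈p' _ = leafValue-cancel p p' p≈p' eq
  ... | tri> _ _ p>p' = contradiction (sym eq) (<⇒≢ (leafValue-< p' p p>p' a'≤s 1≤a))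

  innerOut : ℕ → ℕ
  innerOut c = upLabel (suc c) + downLabel (suc c)

  innerDown : ℕ → ℕ
  innerDown c = suc (suc c) + downLabel (suc c)

  innerOut-cases : ∀ {c} → suc c < K → (c ≡ suc k × innerOut c ≡ K) ⊎ innerOut c ≡ K + innerDown c
  innerOut-cases {c} c+1<K with upLabel-cases (suc c) c+1<K
  ... | inj₁ (refl , l) = inj₁ (refl , cong (_+ (2 + k)) l)
  ... | inj₂ (_ , l)    = inj₂ (trans (cong (_+ downLabel (suc c)) l) (+-assoc K (suc (suc c)) _))

  innerDown-injective : ∀ c c' → innerDown c ≡ innerDown c' → c ≡ c'
  innerDown-injective zero    zero     _  = refl
  innerDown-injective (suc c) (suc c') eq =
    cong suc (+-double-injective (+-cancelˡ-≡ 5 _ _ (trans (sym (normalise c)) (trans eq (normalise c')))))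
    where
    normalise : ∀ c → suc (suc (suc c)) + suc (suc c) ≡ 5 + (c + c)
    normalise = solve-∀

  innerOut-injective : ∀ {c c'} → suc c < K → suc c' < K → innerOut c ≡ innerOut c' → c ≡ c'
  innerOut-injective {c} {c'} h h' eq with innerOut-cases h | innerOut-cases h'
  ... | inj₁ (refl , _) | inj₁ (refl , _) = refl
  ... | inj₁ (_ , o)    | inj₂ o'         = contradiction (trans (sym o) (trans eq o')) (<⇒≢ (m<m+n K z<s))
  ... | inj₂ o          | inj₁ (_ , o')   = contradiction (trans (sym o') (trans (sym eq) o)) (<⇒≢ (m<m+n K z<s))
  ... | inj₂ o          | inj₂ o'         = innerDown-injective c c' (+-cancelˡ-≡ K _ _ (trans (sym o) (trans eq o')))

  K≤innerOut : ∀ {c} → suc c < K → K ≤ innerOut c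
  K≤innerOut h with innerOut-cases h
  ... | inj₁ (_ , o) = ≤-reflexive (sym o)
  ... | inj₂ o       = ≤-trans (m≤m+n K _) (≤-reflexive (sym o))

  0<S : 0 < S
  0<S = <-trans 0<s (n<triangle s 2≤s)

  S<s² : S < s * s
  S<s² = triangle<square s 2≤s

  centreValue-injective : ∀ {b b'} (p : Position K b) (p' : Position K b') → centreValue p ≡ centreValue p' → b ≡ b'
  centreValue-injective first         first          _  = refl
  centreValue-injective first         last           eq = contradiction (*²+-cancel s S 0<s eq) K+1≢K
    where
    K+1≢K : K + 1 ≢ K
    K+1≢K e = <⇒≢ (m<m+n K z<s) (sym e)
  centreValue-injective first         (inner _)      eq = contradiction eq (*²+S≢*²+2S s 0<S S<s²)
  centreValue-injective last          first          eq = sym (centreValue-injective first last (sym eq))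
  centreValue-injective last          last           _  = refl
  centreValue-injective last          (inner _)      eq = contradiction eq (*²+S≢*²+2S s 0<S S<s²)
  centreValue-injective (inner _)     first          eq = contradiction (sym eq) (*²+S≢*²+2S s 0<S S<s²)
  centreValue-injective (inner _)     last           eq = contradiction (sym eq) (*²+S≢*²+2S s 0<S S<s²)
  centreValue-injective (inner h)     (inner h')     eq = cong suc (innerOut-injective h h' (*²+-cancel s (S + S) 0<s eq))

  leafValue≤ : ∀ {b} (p : Position K b) {a} → a ≤ s → leafValue p a ≤ s * (3 * K) + s
  leafValue≤ first             a≤s = ≤-trans a≤s (m≤n+m s _)
  leafValue≤ last  {a}         a≤s = ≤-trans (≤-reflexive (+-comm s a)) (+-monoˡ-≤ s (≤-trans a≤s (m≤m*n s (3 * K))))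
  leafValue≤ (inner {c} c+1<K) {a} a≤s = begin
    s * P + (a + a)      ≤⟨ +-monoʳ-≤ (s * P) (+-mono-≤ a≤s a≤s) ⟩
    s * P + (s + s)      ≡⟨ carry s P ⟩
    s * suc P + s        ≤⟨ +-monoˡ-≤ s (*-monoʳ-≤ s (begin
      suc P                                ≡⟨ regroup c K ⟩
      K + (suc (suc c) + suc (suc c))      ≤⟨ +-monoʳ-≤ K (+-mono-≤ c+1<K c+1<K) ⟩
      K + (K + K)                          ≡⟨ triple K ⟩
      3 * K                                ∎)) ⟩
    s * (3 * K) + s      ∎
    where
    open ≤-Reasoning
    P : ℕ
    P = suc (suc c) + (K + suc c)
    carry : ∀ s P → s * P + (s + s) ≡ s * suc P + s
    carry = solve-∀
    regroup : ∀ c K → suc (suc (suc c) + (K + suc c)) ≡ K + (suc (suc c) + suc (suc c))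
    regroup = solve-∀
    triple : ∀ K → K + (K + K) ≡ 3 * K
    triple = solve-∀

  centreValue≥ : ∀ {b} (p : Position K b) → s * (s * K) + S ≤ centreValue p
  centreValue≥ first     = +-monoˡ-≤ S (*-monoʳ-≤ s (*-monoʳ-≤ s (m≤m+n K 1)))
  centreValue≥ last      = ≤-refl
  centreValue≥ (inner h) = +-mono-≤ (*-monoʳ-≤ s (*-monoʳ-≤ s (K≤innerOut h))) (m≤m+n S S)

  leafValue<centreValue : ∀ {b b'} (p : Position K b) (p' : Position K b') {a} → a ≤ s → leafValue p a < centreValue p'
  leafValue<centreValue p p' a≤s = ≤-<-trans (leafValue≤ p a≤s)
    (<-≤-trans (+-mono-≤-< (*-monoʳ-≤ s (*-monoˡ-≤ K 3≤s)) (n<triangle s 2≤s)) (centreValue≥ p'))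

  vertexSum-injective : ∀ a b a' b' → vertexSum a b ≡ vertexSum a' b' → a ≡ a' × b ≡ b'
  vertexSum-injective zero    b zero     b' eq = refl , toℕ-injective (centreValue-injective (position-of b) (position-of b') eq)
  vertexSum-injective zero    b (suc a') b' eq =
    contradiction (sym eq) (<⇒≢ (leafValue<centreValue (position-of b') (position-of b) (toℕ<n a')))
  vertexSum-injective (suc a) b zero     b' eq =
    contradiction eq (<⇒≢ (leafValue<centreValue (position-of b) (position-of b') (toℕ<n a)))
  vertexSum-injective (suc a) b (suc a') b' eq
    with leafValue-injective (position-of b) (position-of b') (s≤s z≤n) (toℕ<n a) (s≤s z≤n) (toℕ<n a') eq
  ... | b≡b' , a+1≡a'+1 = cong suc (toℕ-injective (suc-injective a+1≡a'+1)) , toℕ-injective b≡b'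

  vsum-injective : ∀ u v → vsum G f u ≡ vsum G f v → u ≡ v
  vsum-injective u v = byCoordinates (remQuot N u) (remQuot N v) (combine-remQuot {suc s} N u) (combine-remQuot {suc s} N v)
    where
    byCoordinates : ∀ {u v} (p q : Fin (suc s) × Fin N) → uncurry vertex p ≡ u → uncurry vertex q ≡ v →
                    vsum G f u ≡ vsum G f v → u ≡ v
    byCoordinates (a , b) (a' , b') refl refl eq
      with vertexSum-injective a b a' b' (trans (sym (vsum-vertex a b)) (trans eq (vsum-vertex a' b')))
    ... | refl , refl = refl

  L : ℕ
  L = s * (K + K)

  ≤K : (v : Fin N) → toℕ v ≤ K
  ≤K v = ≤-pred (toℕ<n v)

  arc-of : ∀ (j y : Fin N) → adj (path N) j y ≡ true → Arc (toℕ j) (toℕ y)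
  arc-of j y = Arc-fromAdj (toℕ j) (toℕ y)

  β-label : ∀ (j y : Fin N) (j~y : adj (path N) j y ≡ true) → β j y ≡ label (arc-of j y j~y)
  β-label j y j~y = arcLabel-label (arc-of j y j~y)

  lab : V G × V G → ℕ
  lab = starLabel s (path N) β

  lab-range : ∀ {e} → e ∈ edges G → 1 ≤ lab e × lab e ≤ L
  lab-range e∈E with ∈⇒Spoke e∈E
  ... | spoke j x y j~y rewrite starLabel-spoke j x y | β-label j y j~y =
    ≤-trans (s≤s z≤n) (m≤n+m _ _) , (begin
      s * q + suc (toℕ x)    ≤⟨ +-monoʳ-≤ (s * q) (toℕ<n x) ⟩
      s * q + s              ≡⟨ trans (+-comm (s * q) s) (sym (*-suc s q)) ⟩
      s * suc q              ≤⟨ *-monoʳ-≤ s (label<2K (arc-of j y j~y) (≤K j) (≤K y)) ⟩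
      L                      ∎)
    where
    open ≤-Reasoning
    q : ℕ
    q = label (arc-of j y j~y)

  lab-injective : ∀ {e e'} → e ∈ edges G → e' ∈ edges G → lab e ≡ lab e' → e ≡ e'
  lab-injective e∈E e'∈E eq with ∈⇒Spoke e∈E | ∈⇒Spoke e'∈E
  ... | spoke j x y j~y | spoke j' x' y' j'~y'
    with *+suc-injective s (toℕ<n x) (toℕ<n x') (trans (sym (starLabel-spoke j x y)) (trans eq (starLabel-spoke j' x' y')))
  ... | β≡β' , x≡x'
    with label-injective (arc-of j y j~y) (arc-of j' y' j'~y') (≤K j) (≤K y) (≤K j') (≤K y')
                         (trans (sym (β-label j y j~y)) (trans β≡β' (β-label j' y' j'~y')))
  ... | j≡j' , y≡y' with toℕ-injective j≡j' | toℕ-injective y≡y' | toℕ-injective x≡x'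
  ...   | refl | refl | refl = refl

  lab-surjective : ∀ l → 1 ≤ l → l ≤ L → ∃ λ e → e ∈ edges G × lab e ≡ l
  lab-surjective (suc t) _ t<L with label-surjective (t / s) (m<n*o⇒m/o<n (subst (t <_) (*-comm s (K + K)) t<L))
  ... | (j , y) , a , j≤K , y≤K , label≡q =
    (vertex zero jF , vertex (suc xF) yF) , spoke-∈ jF xF yF jF~yF , (begin
      lab (vertex zero jF , vertex (suc xF) yF)        ≡⟨ starLabel-spoke jF xF yF ⟩
      s * arcLabel (toℕ jF) (toℕ yF) + suc (toℕ xF)
        ≡⟨ cong₂ _+_ (cong (s *_) (cong₂ arcLabel (toℕ-fromℕ< (s≤s j≤K)) (toℕ-fromℕ< (s≤s y≤K))))
                     (cong suc (toℕ-fromℕ< (m%n<n t s))) ⟩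
      s * arcLabel j y + suc (t % s)                   ≡⟨ cong (λ q → s * q + suc (t % s)) (trans (arcLabel-label a) label≡q) ⟩
      s * (t / s) + suc (t % s)
        ≡⟨ trans (+-suc _ _) (cong suc (trans (+-comm _ (t % s)) (cong (t % s +_) (*-comm s (t / s))))) ⟩
      suc (t % s + t / s * s)                          ≡⟨ cong suc (sym (m≡m%n+[m/n]*n t s)) ⟩
      suc t                                            ∎)
    where
    open ≡-Reasoning
    jF yF : Fin N
    jF = fromℕ< (s≤s j≤K)
    yF = fromℕ< (s≤s y≤K)
    xF : Fin s
    xF = fromℕ< (m%n<n t s)
    jF~yF : adj (path N) jF yF ≡ true
    jF~yF = subst₂ (λ j y → ((suc j ≡ᵇ y) ∨ (suc y ≡ᵇ j)) ≡ true)
                   (sym (toℕ-fromℕ< (s≤s j≤K))) (sym (toℕ-fromℕ< (s≤s y≤K))) (Arc-adj a)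

  antimagic : Antimagic G
  antimagic = f , isBijLabel-fromEdges G lab L lab-range lab-injective lab-surjective ,
              λ u v u≢v eq → u≢v (vsum-injective u v eq)

star⊗path-antimagic : ∀ s k → 3 ≤ s → Antimagic (star s ⊗ path (4 + k))
star⊗path-antimagic s k 3≤s = StarPathLabelling.antimagic s k 3≤s

theorem2p3 : (s m : ℕ) → 3 ≤ s → 1 ≤ m → Antimagic (star s ⊗ path (2 * m + 2))
theorem2p3 s (suc m) 3≤s _ =
  subst (λ n → Antimagic (star s ⊗ path n)) (4+2m≡2[1+m]+2 m) (star⊗path-antimagic s (2 * m) 3≤s)
  where
  4+2m≡2[1+m]+2 : ∀ m → 4 + 2 * m ≡ 2 * suc m + 2
  4+2m≡2[1+m]+2 = solve-∀
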